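{- Let $G$ be a finite abelian group and let $F \subseteq \mathcal C(G)$ be a face of the group cone, with Kunz subgroup $H$ and Kunz poset $P=(G/H,\preceq)$. Define a commutative operation $\oplus$ on the set $N=(G/H)\cup\{\infty\}$ by declaring $\infty\oplus u=u\oplus\infty=\infty$ for all $u\in N$, and, for $a,b\in G$, \[ \overline a\oplus\overline b=\begin{cases}\overline a+\overline b & \text{if } x_a+x_b=x_{a+b}\text{ for all } x\in F,\\ \infty & \text{otherwise.}\end{cases} \] Then $(N,\oplus)$ is a partly cancellative nilsemigroup with identity (called the Kunz nilsemigroup of $F$). Moreover, the divisibility poset of $N\setminus\{\infty\}$ (in which $u\le v$ iff $u\oplus w=v$ for some $w\in N\setminus\{\infty\}$) equals the Kunz poset $P$ of $F$.
   Context: Let $G$ be a finite abelian group, $m=|G|$. The group cone $\mathcal C(G)\subseteq\mathbb R^{G\setminus\{0\}}$ (coordinates $x_g$ indexed by $g\in G\setminus\{0\}$) is the set of $x$ with $x_i+x_j\ge x_{i+j}$ for all $i,j\in G\setminus\{0\}$ with $i+j\ne 0$; throughout, set $x_0:=0$. A face of $\mathcal C(G)$ is a nonempty set of the form $\{x\in\mathcal C(G): x_i+x_j=x_{i+j}\text{ for all }(i,j)\in E\}$ for some set $E$ of such index pairs. The Kunz subgroup of a face $F$ is $H=\{h\in G: x_h=0\text{ for all }x\in F\}$. It is known that $H$ is a subgroup of $G$, that whether "$x_a+x_b=x_{a+b}$ for all $x\in F$" holds depends only on the cosets $a+H,b+H$ (so $\oplus$ is well defined), and that the relation on $G/H$ having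 $\overline 0$ as unique minimal element and $\overline a\preceq\overline b$ for distinct $\overline a,\overline b$ with $a,b\in G\setminus H$ whenever $x_a+x_{b-a}=x_b$ for all $x\in F$, is a partial order, called the Kunz poset of $F$. Semigroup terminology: in a commutative semigroup $(N,+)$, a nil is an element $\infty$ with $a+\infty=\infty$ for all $a$; an element $a$ is nilpotent if $na=\infty$ for some integer $n\ge1$; $a$ is partly cancellative if $a+b=a+c\ne\infty$ implies $b=c$. $N$ is a nilsemigroup with identity if it has an identity element and every non-identity element is nilpotent; it is partly cancellative if every non-nil element is partly cancellative.
   Formalization: Points of the group cone $\mathcal C(G)$, and hence of the face F, have rational rather than real coordinates. -}

module Defs where

open import Data.Nat using (ℕ; zero; suc)
open import Data.Fin using (Fin)
open import Data.Maybe using (Maybe; just; nothing)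
open import Data.Product using (Σ; _×_; ∃)
open import Data.Sum using (_⊎_)
open import Data.Empty using (⊥)
open import Data.Unit using (⊤)
open import Data.Rational using (ℚ; 0ℚ; _+_; _≤_)
open import Relation.Nullary using (¬_)
open import Relation.Binary.PropositionalEquality using (_≡_; _≢_)
open import Algebra.Structures using (IsAbelianGroup)

-- A finite abelian group, presented on the carrier Fin m (every finite
-- abelian group is isomorphic to one of this form), with propositional equality.
record FinAbGroup : Set where
  field
    m        : ℕ
    _+ᴳ_     : Fin m → Fin m → Fin m
    0ᴳ       : Fin m
    -ᴳ_      : Fin m → Fin m
    isAbGrp  : IsAbelianGroup _≡_ _+ᴳ_ 0ᴳ -ᴳ_

module _ {A : Set} (_≈_ : A → A → Set) (_∙_ : A → A → A) where

  -- n-fold sum  pow n u = u ∙ (u ∙ ... ∙ u)  with (suc n) copies of u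
  pow : ℕ → A → A
  pow zero    u = u
  pow (suc n) u = u ∙ pow n u

  IsNil : A → Set
  IsNil z = ∀ a → (a ∙ z) ≈ z × (z ∙ a) ≈ z

  IsNilpotent : A → A → Set
  IsNilpotent z a = ∃ λ n → pow n a ≈ z

  IsPartlyCancellativeElt : A → A → Set
  IsPartlyCancellativeElt z a =
    ∀ b c → (a ∙ b) ≈ (a ∙ c) → ¬ ((a ∙ b) ≈ z) → b ≈ c

  IsNilsemigroupWithIdentity : A → A → Set
  IsNilsemigroupWithIdentity e z =
    (∀ a → (a ∙ e) ≈ a × (e ∙ a) ≈ a) × IsNil z × (∀ a → ¬ (a ≈ e) → IsNilpotent z a)

  IsPartlyCancellative : A → Set
  IsPartlyCancellative z = ∀ a → ¬ (a ≈ z) → IsPartlyCancellativeElt z a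

module _ (G : FinAbGroup) where
  open FinAbGroup G

  -- points: vectors indexed by G, with the convention x_0 = 0
  Point : Set
  Point = Fin m → ℚ

  InCone : Point → Set
  InCone x = x 0ᴳ ≡ 0ℚ ×
    (∀ i j → i ≢ 0ᴳ → j ≢ 0ᴳ → (i +ᴳ j) ≢ 0ᴳ → x (i +ᴳ j) ≤ x i + x j)

  PairSet : Set₁
  PairSet = Fin m → Fin m → Set

  ValidPairs : PairSet → Set
  ValidPairs E = ∀ i j → E i j → i ≢ 0ᴳ × j ≢ 0ᴳ × (i +ᴳ j) ≢ 0ᴳ

  -- the face F_E = { x ∈ C(G) : x_i + x_j = x_{i+j} for (i,j) ∈ E }
  InFace : PairSet → Point → Set
  InFace E x = InCone x × (∀ i j → E i j → x i + x j ≡ x (i +ᴳ j))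

  Additive : PairSet → Fin m → Fin m → Set
  Additive E a b = ∀ x → InFace E x → x a + x b ≡ x (a +ᴳ b)

  InKunz : PairSet → Fin m → Set
  InKunz E h = ∀ x → InFace E x → x h ≡ 0ℚ

  SameCoset : PairSet → Fin m → Fin m → Set
  SameCoset E a b = InKunz E (a +ᴳ (-ᴳ b))

  -- N = (G/H) ∪ {∞}, represented by Maybe G (nothing = ∞) modulo _≈N_
  N : Set
  N = Maybe (Fin m)

  ≈N : PairSet → N → N → Set
  ≈N E nothing  nothing  = ⊤
  ≈N E nothing  (just _) = ⊥
  ≈N E (just _) nothing  = ⊥
  ≈N E (just a) (just b) = SameCoset E a b

  -- specification of the operation ⊕ (on representatives)
  IsKunzOp : PairSet → (N → N → N) → Set
  IsKunzOp E op =
    (∀ u → op nothing u ≡ nothing × op u nothing ≡ nothing) ×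
    (∀ a b → Additive E a b → op (just a) (just b) ≡ just (a +ᴳ b)) ×
    (∀ a b → ¬ Additive E a b → op (just a) (just b) ≡ nothing)

  KunzLeq : PairSet → Fin m → Fin m → Set
  KunzLeq E a b =
    SameCoset E a b ⊎ InKunz E a ⊎
    (¬ InKunz E a × ¬ InKunz E b × Additive E a (b +ᴳ (-ᴳ a)))

-- A point x of the group cone satisfies x (i + j) ≤ x i + x j unless i + j = 0, and even then
-- as soon as some k lies outside {0, j}.  Iterating along multiples of g gives x g ≥ 0 (outside
-- the two-element group), and x h = 0 forces x (-h) = 0 and x (h + a) = x a.  So the Kunz
-- subgroup H is a subgroup, every x ∈ F is H-periodic and ⊕ descends to G/H.  Associativity
-- comes from the squeeze x (a+b+c) ≤ x a + x (b+c) ≤ x a + x b + x c: if the ends agree for all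
-- x ∈ F, so do x (b+c) and x b + x c.  If no power of ā is ∞, then x ((n+1)a) = (n+1) x a along
-- the chain, and at the order of a this forces x a = 0, i.e. ā = 0̄.  Finally ā ⊕ (-ā) ≠ ∞
-- exactly when a ∈ H, which identifies divisibility in N with the Kunz order.

module Submission where

open import Defs
open import Algebra.Bundles using (AbelianGroup)
open import Algebra.Structures using (IsCommutativeMonoid)
open import Data.Fin using (Fin; toℕ; _≟_)
open import Data.Fin.Properties using (pigeonhole)
open import Data.Maybe using (just; nothing)
open import Data.Maybe.Properties using (just-injective)
open import Data.Nat as ℕ using (zero; suc)
import Data.Nat.Properties as ℕ
open import Data.Product using (Σ; _×_; ∃; _,_; proj₁; proj₂)
open import Data.Rational using (ℚ; 0ℚ; _+_; _≤_; _<_; -_)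
import Data.Rational.Properties as ℚ
open import Data.Sum using (inj₁; inj₂)
open import Data.Unit using (tt)
open import Function using (_∘_; case_of_)
open import Level using (0ℓ)
open import Relation.Binary.Core using (Rel)
open import Relation.Binary.Definitions using (tri<; tri≈; tri>; _Respects_)
open import Relation.Binary.PropositionalEquality
  using (_≡_; _≢_; refl; sym; trans; cong; cong₂; subst; module ≡-Reasoning)
open import Relation.Binary.Structures using (IsEquivalence)
open import Relation.Nullary using (¬_; Dec; yes; no; contradiction)
open import Relation.Nullary.Decidable using (decidable-stable; map′)

import Algebra.Properties.AbelianGroup ℚ.+-0-abelianGroup as ℚ-Group
open import Algebra.Properties.Monoid.Mult ℚ.+-0-monoid using () renaming (_×_ to _×ℚ_)

private variable p q : ℚ

+-cancelˡ-≤ : ∀ r → r + p ≤ r + q → p ≤ q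
+-cancelˡ-≤ {p} {q} r r+p≤r+q = begin
  p              ≡⟨ ℚ-Group.\\-leftDividesʳ r p ⟨
  - r + (r + p)  ≤⟨ ℚ.+-monoʳ-≤ (- r) r+p≤r+q ⟩
  - r + (r + q)  ≡⟨ ℚ-Group.\\-leftDividesʳ r q ⟩
  q              ∎
  where open ℚ.≤-Reasoning

p+q≡0⇒p≡0 : 0ℚ ≤ p → 0ℚ ≤ q → p + q ≡ 0ℚ → p ≡ 0ℚ
p+q≡0⇒p≡0 {p} {q} 0≤p 0≤q p+q≡0 = ℚ.≤-antisym (begin
  p       ≡⟨ ℚ.+-identityʳ p ⟨
  p + 0ℚ  ≤⟨ ℚ.+-monoʳ-≤ p 0≤q ⟩
  p + q   ≡⟨ p+q≡0 ⟩
  0ℚ      ∎) 0≤p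
  where open ℚ.≤-Reasoning

×ℚ-zeroʳ : ∀ n → n ×ℚ 0ℚ ≡ 0ℚ
×ℚ-zeroʳ zero    = refl
×ℚ-zeroʳ (suc n) = trans (ℚ.+-identityˡ (n ×ℚ 0ℚ)) (×ℚ-zeroʳ n)

×ℚ-monoʳ-< : ∀ n → p < q → suc n ×ℚ p < suc n ×ℚ q
×ℚ-monoʳ-< zero    p<q = ℚ.+-mono-<-≤ p<q ℚ.≤-refl
×ℚ-monoʳ-< (suc n) p<q = ℚ.+-mono-< p<q (×ℚ-monoʳ-< n p<q)

×ℚ-neg : ∀ n → p < 0ℚ → suc n ×ℚ p < 0ℚ
×ℚ-neg {p} n p<0 = subst (suc n ×ℚ p <_) (×ℚ-zeroʳ (suc n)) (×ℚ-monoʳ-< n p<0)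

suc×p≡0⇒p≡0 : ∀ n → suc n ×ℚ p ≡ 0ℚ → p ≡ 0ℚ
suc×p≡0⇒p≡0 {p} n n·p≡0 with ℚ.<-cmp p 0ℚ
... | tri< p<0 _ _ = contradiction n·p≡0 (ℚ.<⇒≢ (×ℚ-neg n p<0))
... | tri≈ _ p≡0 _ = p≡0
... | tri> _ _ p>0 = contradiction (sym n·p≡0)
      (ℚ.<⇒≢ (subst (_< suc n ×ℚ p) (×ℚ-zeroʳ (suc n)) (×ℚ-monoʳ-< n p>0)))

module SubgroupCosets {c ℓ p} (G : AbelianGroup c ℓ) {P : AbelianGroup.Carrier G → Set p}
  (P-resp : P Respects AbelianGroup._≈_ G) (P-ε : P (AbelianGroup.ε G))
  (P-∙ : ∀ {x y} → P x → P y → P (AbelianGroup._∙_ G x y))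
  (P-⁻¹ : ∀ {x} → P x → P (AbelianGroup._⁻¹ G x)) where

  open AbelianGroup G renaming (refl to ≈-refl; sym to ≈-sym)
  open import Algebra.Properties.AbelianGroup G
  open import Algebra.Properties.CommutativeSemigroup commutativeSemigroup using (interchange)
  open import Relation.Binary.Reasoning.Setoid setoid

  _∼_ : Rel Carrier p
  x ∼ y = P (x ∙ y ⁻¹)

  ∼-reflexive : ∀ {x y} → x ≈ y → x ∼ y
  ∼-reflexive x≈y = P-resp (≈-sym (x≈y⇒x∙y⁻¹≈ε x≈y)) P-ε

  ∼-refl : ∀ {x} → x ∼ x
  ∼-refl = ∼-reflexive ≈-refl

  ∼-sym : ∀ {x y} → x ∼ y → y ∼ x
  ∼-sym {x} {y} x∼y = P-resp (⁻¹-anti-homo-// x y) (P-⁻¹ x∼y)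

  ∼-trans : ∀ {x y z} → x ∼ y → y ∼ z → x ∼ z
  ∼-trans {x} {y} {z} x∼y y∼z = P-resp (begin
    x ∙ y ⁻¹ ∙ (y ∙ z ⁻¹)    ≈⟨ assoc x (y ⁻¹) (y ∙ z ⁻¹) ⟩
    x ∙ (y ⁻¹ ∙ (y ∙ z ⁻¹))  ≈⟨ ∙-congˡ (\\-leftDividesʳ y (z ⁻¹)) ⟩
    x ∙ z ⁻¹                 ∎) (P-∙ x∼y y∼z)

  ∙-cong-∼ : ∀ {x x′ y y′} → x ∼ x′ → y ∼ y′ → (x ∙ y) ∼ (x′ ∙ y′)
  ∙-cong-∼ {x} {x′} {y} {y′} x∼x′ y∼y′ = P-resp (begin
    x ∙ x′ ⁻¹ ∙ (y ∙ y′ ⁻¹)  ≈⟨ interchange x (x′ ⁻¹) y (y′ ⁻¹) ⟩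
    x ∙ y ∙ (x′ ⁻¹ ∙ y′ ⁻¹)  ≈⟨ ∙-congˡ (⁻¹-∙-comm x′ y′) ⟩
    x ∙ y ∙ (x′ ∙ y′) ⁻¹     ∎) (P-∙ x∼x′ y∼y′)

  ∼-cancelˡ : ∀ {x y z} → (x ∙ y) ∼ (x ∙ z) → y ∼ z
  ∼-cancelˡ {x} {y} {z} xy∼xz =
    ∼-trans (∼-reflexive (≈-sym (\\-leftDividesʳ x y)))
      (∼-trans (∙-cong-∼ ∼-refl xy∼xz) (∼-reflexive (\\-leftDividesʳ x z)))

abelianGroup : FinAbGroup → AbelianGroup 0ℓ 0ℓ
abelianGroup G = record { isAbelianGroup = FinAbGroup.isAbGrp G }

module FinAbGroupProperties (G : FinAbGroup) where
  open FinAbGroup G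
  open AbelianGroup (abelianGroup G) public
    using (assoc; comm; identityˡ; identityʳ; inverseʳ)
  open import Algebra.Properties.AbelianGroup (abelianGroup G) public
  open import Algebra.Properties.Monoid.Mult (AbelianGroup.monoid (abelianGroup G))
    using (×-homo-+)
  open import Algebra.Properties.Monoid.Mult (AbelianGroup.monoid (abelianGroup G)) public
    using () renaming (_×_ to _×ᴳ_)
  open ≡-Reasoning

  ×-order : ∀ g → ∃ λ n → suc n ×ᴳ g ≡ 0ᴳ
  ×-order g
    with i , j , i<j , i·g≡j·g ← pigeonhole (ℕ.n<1+n m) (λ (i : Fin (suc m)) → toℕ i ×ᴳ g)
    with o , i+1+o≡j ← ℕ.m≤n⇒∃[o]m+o≡n i<j
    = o , identityʳ-unique (toℕ i ×ᴳ g) (suc o ×ᴳ g) (begin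
      (toℕ i ×ᴳ g) +ᴳ (suc o ×ᴳ g)  ≡⟨ ×-homo-+ g (toℕ i) (suc o) ⟨
      (toℕ i ℕ.+ suc o) ×ᴳ g        ≡⟨ cong (_×ᴳ g) (trans (ℕ.+-suc (toℕ i) o) i+1+o≡j) ⟩
      toℕ j ×ᴳ g                    ≡⟨ i·g≡j·g ⟨
      toℕ i ×ᴳ g                    ∎)

  -ᴳ-multiple : ∀ g → ∃ λ n → n ×ᴳ g ≡ -ᴳ g
  -ᴳ-multiple g with n , suc-n·g≡0 ← ×-order g = n , inverseʳ-unique g (n ×ᴳ g) suc-n·g≡0

  x+[y-x]≡y : ∀ x y → x +ᴳ (y +ᴳ (-ᴳ x)) ≡ y
  x+[y-x]≡y x y = trans (sym (assoc x y (-ᴳ x))) (xyx⁻¹≈y x y)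

module ConePoint (G : FinAbGroup) {x : Point G} (x∈C : InCone G x) where
  open FinAbGroup G
  open FinAbGroupProperties G
  open ℚ.≤-Reasoning

  x0≡0 : x 0ᴳ ≡ 0ℚ
  x0≡0 = proj₁ x∈C

  additive-0ᴳˡ : ∀ c → x 0ᴳ + x c ≡ x (0ᴳ +ᴳ c)
  additive-0ᴳˡ c = begin-equality
    x 0ᴳ + x c    ≡⟨ cong (_+ x c) x0≡0 ⟩
    0ℚ + x c      ≡⟨ ℚ.+-identityˡ (x c) ⟩
    x c           ≡⟨ cong x (identityˡ c) ⟨
    x (0ᴳ +ᴳ c)   ∎

  additive-0ᴳʳ : ∀ b → x b + x 0ᴳ ≡ x (b +ᴳ 0ᴳ)
  additive-0ᴳʳ b = begin-equality
    x b + x 0ᴳ    ≡⟨ cong (x b +_) x0≡0 ⟩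
    x b + 0ℚ      ≡⟨ ℚ.+-identityʳ (x b) ⟩
    x b           ≡⟨ cong x (identityʳ b) ⟨
    x (b +ᴳ 0ᴳ)   ∎

  subadditive : ∀ i j → i +ᴳ j ≢ 0ᴳ → x (i +ᴳ j) ≤ x i + x j
  subadditive i j i+j≢0 with i ≟ 0ᴳ | j ≟ 0ᴳ
  ... | yes refl | _        = ℚ.≤-reflexive (sym (additive-0ᴳˡ j))
  ... | no _     | yes refl = ℚ.≤-reflexive (sym (additive-0ᴳʳ i))
  ... | no i≢0   | no j≢0   = proj₂ x∈C i j i≢0 j≢0 i+j≢0

  antipodal-nonneg : ∀ {g k} → k ≢ 0ᴳ → k ≢ -ᴳ g → 0ℚ ≤ x g + x (-ᴳ g)
  antipodal-nonneg {g} {k} k≢0 k≢-g = +-cancelˡ-≤ (x k) (begin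
    x k + 0ℚ                ≡⟨ ℚ.+-identityʳ (x k) ⟩
    x k                     ≡⟨ cong x k+g-g≡k ⟨
    x ((k +ᴳ g) +ᴳ (-ᴳ g))  ≤⟨ subadditive (k +ᴳ g) (-ᴳ g) (k≢0 ∘ trans (sym k+g-g≡k)) ⟩
    x (k +ᴳ g) + x (-ᴳ g)   ≤⟨ ℚ.+-monoˡ-≤ (x (-ᴳ g)) (subadditive k g k+g≢0) ⟩
    x k + x g + x (-ᴳ g)    ≡⟨ ℚ.+-assoc (x k) (x g) (x (-ᴳ g)) ⟩
    x k + (x g + x (-ᴳ g))  ∎)
    where
    k+g-g≡k : (k +ᴳ g) +ᴳ (-ᴳ g) ≡ k
    k+g-g≡k = //-rightDividesʳ g k
    k+g≢0 : k +ᴳ g ≢ 0ᴳ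
    k+g≢0 = k≢-g ∘ inverseˡ-unique k g

  triangle : ∀ {i j k} → k ≢ 0ᴳ → k ≢ j → x (i +ᴳ j) ≤ x i + x j
  triangle {i} {j} k≢0 k≢j with (i +ᴳ j) ≟ 0ᴳ
  ... | no i+j≢0  = subadditive i j i+j≢0
  ... | yes i+j≡0 = begin
    x (i +ᴳ j)      ≡⟨ cong x i+j≡0 ⟩
    x 0ᴳ            ≡⟨ x0≡0 ⟩
    0ℚ              ≤⟨ antipodal-nonneg k≢0 (subst (_ ≢_) j≡-i k≢j) ⟩
    x i + x (-ᴳ i)  ≡⟨ cong (λ y → x i + x y) j≡-i ⟨
    x i + x j       ∎
    where
    j≡-i : j ≡ -ᴳ i
    j≡-i = inverseʳ-unique i j i+j≡0

  ×-subadditive : ∀ {g k} → k ≢ 0ᴳ → k ≢ g → ∀ n → x (n ×ᴳ g) ≤ n ×ℚ x g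
  ×-subadditive k≢0 k≢g zero = ℚ.≤-reflexive x0≡0
  ×-subadditive {g} k≢0 k≢g (suc n) = begin
    x (g +ᴳ (n ×ᴳ g))  ≡⟨ cong x (comm g (n ×ᴳ g)) ⟩
    x ((n ×ᴳ g) +ᴳ g)  ≤⟨ triangle k≢0 k≢g ⟩
    x (n ×ᴳ g) + x g   ≡⟨ ℚ.+-comm (x (n ×ᴳ g)) (x g) ⟩
    x g + x (n ×ᴳ g)   ≤⟨ ℚ.+-monoʳ-≤ (x g) (×-subadditive k≢0 k≢g n) ⟩
    x g + n ×ℚ x g     ∎

  -- The witness k rules out G = {0, g}, where the cone does not constrain x g at all.
  nonneg : ∀ {g k} → k ≢ 0ᴳ → k ≢ g → 0ℚ ≤ x g
  nonneg {g} k≢0 k≢g with n , suc-n·g≡0 ← ×-order g = ℚ.≮⇒≥ λ xg<0 → ℚ.<-irrefl refl (begin-strict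
    0ℚ              ≡⟨ x0≡0 ⟨
    x 0ᴳ            ≡⟨ cong x suc-n·g≡0 ⟨
    x (suc n ×ᴳ g)  ≤⟨ ×-subadditive k≢0 k≢g (suc n) ⟩
    suc n ×ℚ x g    <⟨ ×ℚ-neg n xg<0 ⟩
    0ℚ              ∎)

  sum≡0⇒≡0 : ∀ a c → x a + x c ≡ 0ℚ → x a ≡ 0ℚ
  sum≡0⇒≡0 a c sum≡0 with a ≟ 0ᴳ | c ≟ 0ᴳ | c ≟ a
  ... | yes refl | _        | _        = x0≡0
  ... | no _     | yes refl | _        =
    trans (sym (trans (additive-0ᴳʳ a) (cong x (identityʳ a)))) sum≡0
  ... | no _     | no _     | yes refl =
    suc×p≡0⇒p≡0 1 (trans (cong (x a +_) (ℚ.+-identityʳ (x a))) sum≡0)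
  ... | no a≢0   | no c≢0   | no c≢a   = p+q≡0⇒p≡0 (nonneg c≢0 c≢a) (nonneg a≢0 (c≢a ∘ sym)) sum≡0

  zero-neg : ∀ {h} → x h ≡ 0ℚ → x (-ᴳ h) ≡ 0ℚ
  zero-neg {h} xh≡0 with h ≟ -ᴳ h
  ... | yes h≡-h = trans (cong x (sym h≡-h)) xh≡0
  ... | no h≢-h with n , n·h≡-h ← -ᴳ-multiple h = ℚ.≤-antisym (begin
    x (-ᴳ h)    ≡⟨ cong x n·h≡-h ⟨
    x (n ×ᴳ h)  ≤⟨ ×-subadditive -h≢0 (h≢-h ∘ sym) n ⟩
    n ×ℚ x h    ≡⟨ cong (n ×ℚ_) xh≡0 ⟩
    n ×ℚ 0ℚ     ≡⟨ ×ℚ-zeroʳ n ⟩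
    0ℚ          ∎) (nonneg h≢0 h≢-h)
    where
    h≢0 : h ≢ 0ᴳ
    h≢0 refl = h≢-h (sym ε⁻¹≈ε)
    -h≢0 : -ᴳ h ≢ 0ᴳ
    -h≢0 -h≡0 = h≢0 (⁻¹-injective (trans -h≡0 (sym ε⁻¹≈ε)))

  zero-shift : ∀ {h} a → x h ≡ 0ℚ → x (h +ᴳ a) ≡ x a
  zero-shift {h} a xh≡0 with a ≟ 0ᴳ | (h +ᴳ a) ≟ 0ᴳ
  ... | yes refl | _ = begin-equality
    x (h +ᴳ 0ᴳ)   ≡⟨ cong x (identityʳ h) ⟩
    x h           ≡⟨ xh≡0 ⟩
    0ℚ            ≡⟨ x0≡0 ⟨
    x 0ᴳ          ∎
  ... | no _ | yes h+a≡0 = begin-equality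
    x (h +ᴳ a)    ≡⟨ cong x h+a≡0 ⟩
    x 0ᴳ          ≡⟨ x0≡0 ⟩
    0ℚ            ≡⟨ zero-neg xh≡0 ⟨
    x (-ᴳ h)      ≡⟨ cong x (inverseʳ-unique h a h+a≡0) ⟨
    x a           ∎
  ... | no a≢0 | no h+a≢0 = ℚ.≤-antisym (begin
    x (h +ᴳ a)                ≤⟨ subadditive h a h+a≢0 ⟩
    x h + x a                 ≡⟨ cong (_+ x a) xh≡0 ⟩
    0ℚ + x a                  ≡⟨ ℚ.+-identityˡ (x a) ⟩
    x a                       ∎) (begin
    x a                       ≡⟨ cong x (xyx⁻¹≈y h a) ⟨
    x ((h +ᴳ a) +ᴳ (-ᴳ h))    ≤⟨ subadditive (h +ᴳ a) (-ᴳ h) (a≢0 ∘ trans (sym (xyx⁻¹≈y h a))) ⟩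
    x (h +ᴳ a) + x (-ᴳ h)     ≡⟨ cong (x (h +ᴳ a) +_) (zero-neg xh≡0) ⟩
    x (h +ᴳ a) + 0ℚ           ≡⟨ ℚ.+-identityʳ (x (h +ᴳ a)) ⟩
    x (h +ᴳ a)                ∎)

  additive-cancelˡ : ∀ a b c → x a + (x b + x c) ≡ x (a +ᴳ (b +ᴳ c)) → x b + x c ≡ x (b +ᴳ c)
  additive-cancelˡ a b c sum≡ with b ≟ 0ᴳ | c ≟ 0ᴳ | (b +ᴳ c) ≟ 0ᴳ
  ... | yes refl | _        | _         = additive-0ᴳˡ c
  ... | no _     | yes refl | _         = additive-0ᴳʳ b
  ... | no _     | no _     | yes b+c≡0 = begin-equality
    x b + x c    ≡⟨ ℚ-Group.identityʳ-unique (x a) (x b + x c) (begin-equality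
      x a + (x b + x c)     ≡⟨ sum≡ ⟩
      x (a +ᴳ (b +ᴳ c))     ≡⟨ cong (λ y → x (a +ᴳ y)) b+c≡0 ⟩
      x (a +ᴳ 0ᴳ)           ≡⟨ cong x (identityʳ a) ⟩
      x a                   ∎) ⟩
    0ℚ           ≡⟨ x0≡0 ⟨
    x 0ᴳ         ≡⟨ cong x b+c≡0 ⟨
    x (b +ᴳ c)   ∎
  ... | no b≢0   | no c≢0   | no b+c≢0  = ℚ.≤-antisym (+-cancelˡ-≤ (x a) (begin
    x a + (x b + x c)   ≡⟨ sum≡ ⟩
    x (a +ᴳ (b +ᴳ c))   ≤⟨ triangle b≢0 (c≢0 ∘ identityʳ-unique b c ∘ sym) ⟩
    x a + x (b +ᴳ c)    ∎)) (subadditive b c b+c≢0)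

module Face (G : FinAbGroup) (E : PairSet G) where
  open FinAbGroup G
  open FinAbGroupProperties G
  open ≡-Reasoning

  private
    module Pt (x : Point G) (x∈F : InFace G E x) = ConePoint G {x} (proj₁ x∈F)

  kunz-0ᴳ : InKunz G E 0ᴳ
  kunz-0ᴳ x x∈F = Pt.x0≡0 x x∈F

  kunz-+ᴳ : ∀ {h k} → InKunz G E h → InKunz G E k → InKunz G E (h +ᴳ k)
  kunz-+ᴳ {h} {k} h∈H k∈H x x∈F = trans (Pt.zero-shift x x∈F k (h∈H x x∈F)) (k∈H x x∈F)

  kunz-neg : ∀ {h} → InKunz G E h → InKunz G E (-ᴳ h)
  kunz-neg h∈H x x∈F = Pt.zero-neg x x∈F (h∈H x x∈F)

  open SubgroupCosets (abelianGroup G) (subst (InKunz G E)) kunz-0ᴳ kunz-+ᴳ kunz-neg public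

  kunz⇒∼0ᴳ : ∀ {a} → InKunz G E a → a ∼ 0ᴳ
  kunz⇒∼0ᴳ {a} = subst (InKunz G E) (sym (trans (cong (a +ᴳ_) ε⁻¹≈ε) (identityʳ a)))

  kunz-periodic : ∀ {a b} → a ∼ b → ∀ x → InFace G E x → x a ≡ x b
  kunz-periodic {a} {b} a∼b x x∈F =
    trans (cong x (sym (//-rightDividesˡ b a))) (Pt.zero-shift x x∈F b (a∼b x x∈F))

  kunz⇒additive : ∀ {a} → InKunz G E a → ∀ b → Additive G E a b
  kunz⇒additive {a} a∈H b x x∈F = begin
    x a + x b     ≡⟨ cong (_+ x b) (a∈H x x∈F) ⟩
    0ℚ + x b      ≡⟨ ℚ.+-identityˡ (x b) ⟩
    x b           ≡⟨ Pt.zero-shift x x∈F b (a∈H x x∈F) ⟨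
    x (a +ᴳ b)    ∎

  additive-kunz⇒kunz : ∀ {a c} → Additive G E a c → InKunz G E (a +ᴳ c) → InKunz G E a
  additive-kunz⇒kunz {a} {c} ac a+c∈H x x∈F =
    Pt.sum≡0⇒≡0 x x∈F a c (trans (ac x x∈F) (a+c∈H x x∈F))

  additive-0ᴳˡ : ∀ b → Additive G E 0ᴳ b
  additive-0ᴳˡ b x x∈F = Pt.additive-0ᴳˡ x x∈F b

  additive-comm : ∀ {a b} → Additive G E a b → Additive G E b a
  additive-comm {a} {b} ab x x∈F = begin
    x b + x a     ≡⟨ ℚ.+-comm (x b) (x a) ⟩
    x a + x b     ≡⟨ ab x x∈F ⟩
    x (a +ᴳ b)    ≡⟨ cong x (comm a b) ⟩
    x (b +ᴳ a)    ∎

  additive-0ᴳʳ : ∀ a → Additive G E a 0ᴳ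
  additive-0ᴳʳ a = additive-comm (additive-0ᴳˡ a)

  additive-resp : ∀ {a a′ b b′} → a ∼ a′ → b ∼ b′ → Additive G E a b → Additive G E a′ b′
  additive-resp {a} {a′} {b} {b′} a∼a′ b∼b′ ab x x∈F = begin
    x a′ + x b′   ≡⟨ cong₂ _+_ (kunz-periodic a∼a′ x x∈F) (kunz-periodic b∼b′ x x∈F) ⟨
    x a + x b     ≡⟨ ab x x∈F ⟩
    x (a +ᴳ b)    ≡⟨ kunz-periodic (∙-cong-∼ a∼a′ b∼b′) x x∈F ⟩
    x (a′ +ᴳ b′)  ∎

  additive-assocˡ : ∀ {a b c} → Additive G E a b → Additive G E (a +ᴳ b) c →
                    Additive G E b c × Additive G E a (b +ᴳ c)
  additive-assocˡ {a} {b} {c} ab [ab]c =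
    bc , λ x x∈F → trans (cong (x a +_) (sym (bc x x∈F))) (sum≡ x x∈F)
    where
    sum≡ : ∀ x → InFace G E x → x a + (x b + x c) ≡ x (a +ᴳ (b +ᴳ c))
    sum≡ x x∈F = begin
      x a + (x b + x c)   ≡⟨ ℚ.+-assoc (x a) (x b) (x c) ⟨
      x a + x b + x c     ≡⟨ cong (_+ x c) (ab x x∈F) ⟩
      x (a +ᴳ b) + x c    ≡⟨ [ab]c x x∈F ⟩
      x ((a +ᴳ b) +ᴳ c)   ≡⟨ cong x (assoc a b c) ⟩
      x (a +ᴳ (b +ᴳ c))   ∎
    bc : Additive G E b c
    bc x x∈F = Pt.additive-cancelˡ x x∈F a b c (sum≡ x x∈F)

  additive-assocʳ : ∀ {a b c} → Additive G E b c → Additive G E a (b +ᴳ c) →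
                    Additive G E a b × Additive G E (a +ᴳ b) c
  additive-assocʳ {a} {b} {c} bc a[bc]
    with ba , c[ba] ← additive-assocˡ (additive-comm bc)
                        (additive-resp (∼-reflexive (comm b c)) ∼-refl (additive-comm a[bc]))
    = additive-comm ba , additive-comm (additive-resp ∼-refl (∼-reflexive (comm b a)) c[ba])

module KunzNilsemigroup (G : FinAbGroup) (E : PairSet G)
                        (op : N G → N G → N G) (isKunzOp : IsKunzOp G E op) where
  open FinAbGroup G
  open FinAbGroupProperties G
  open Face G E

  private
    _≈_ : N G → N G → Set
    _≈_ = ≈N G E

  ∞-absorbˡ : ∀ u → op nothing u ≡ nothing
  ∞-absorbˡ u = proj₁ (proj₁ isKunzOp u)

  ∞-absorbʳ : ∀ u → op u nothing ≡ nothing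
  ∞-absorbʳ u = proj₂ (proj₁ isKunzOp u)

  ⊕-additive : ∀ {a b} → Additive G E a b → op (just a) (just b) ≡ just (a +ᴳ b)
  ⊕-additive = proj₁ (proj₂ isKunzOp) _ _

  ⊕-nonadditive : ∀ {a b} → ¬ Additive G E a b → op (just a) (just b) ≡ nothing
  ⊕-nonadditive = proj₂ (proj₂ isKunzOp) _ _

  additive-stable : ∀ {a b} → ¬ ¬ Additive G E a b → Additive G E a b
  additive-stable {a} {b} ¬¬ab x x∈F =
    decidable-stable (x a + x b ℚ.≟ x (a +ᴳ b)) λ ≢ → ¬¬ab λ ab → ≢ (ab x x∈F)

  data ⊕-View (a b : Fin m) : N G → Set where
    additive    : Additive G E a b → ⊕-View a b (just (a +ᴳ b))
    nonadditive : ¬ Additive G E a b → ⊕-View a b nothing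

  ⊕-view : ∀ a b → ⊕-View a b (op (just a) (just b))
  ⊕-view a b with op (just a) (just b) in eq
  ... | nothing = nonadditive λ ab → case trans (sym (⊕-additive ab)) eq of λ ()
  ... | just d  =
    subst (⊕-View a b ∘ just) (just-injective (trans (sym (⊕-additive ab)) eq)) (additive ab)
    where
    ab : Additive G E a b
    ab = additive-stable λ ¬ab → case trans (sym eq) (⊕-nonadditive ¬ab) of λ ()

  additive? : ∀ a b → Dec (Additive G E a b)
  additive? a b with op (just a) (just b) | ⊕-view a b
  ... | _ | additive ab     = yes ab
  ... | _ | nonadditive ¬ab = no ¬ab

  kunz? : ∀ a → Dec (InKunz G E a)
  kunz? a = map′ (λ a-a → additive-kunz⇒kunz a-a ∼-refl) (λ a∈H → kunz⇒additive a∈H (-ᴳ a))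
                 (additive? a (-ᴳ a))

  ≈-∞ : ∀ {u v} → u ≡ nothing → v ≡ nothing → u ≈ v
  ≈-∞ refl refl = tt

  ≈-refl : ∀ {u} → u ≈ u
  ≈-refl {nothing} = tt
  ≈-refl {just a}  = ∼-refl

  ≈-sym : ∀ {u v} → u ≈ v → v ≈ u
  ≈-sym {nothing} {nothing} _   = tt
  ≈-sym {just a}  {just b}  a∼b = ∼-sym a∼b

  ≈-trans : ∀ {u v w} → u ≈ v → v ≈ w → u ≈ w
  ≈-trans {nothing} {nothing} {nothing} _   _   = tt
  ≈-trans {just a}  {just b}  {just c}  a∼b b∼c = ∼-trans a∼b b∼c

  ≈-isEquivalence : IsEquivalence _≈_
  ≈-isEquivalence = record { refl = ≈-refl ; sym = ≈-sym ; trans = ≈-trans }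

  ≈-⊕ : ∀ {a b a′ b′} → (Additive G E a b → Additive G E a′ b′) →
        (Additive G E a′ b′ → Additive G E a b) → (a +ᴳ b) ∼ (a′ +ᴳ b′) →
        op (just a) (just b) ≈ op (just a′) (just b′)
  ≈-⊕ {a} {b} {a′} {b′} to from sum∼
    with op (just a) (just b) | ⊕-view a b | op (just a′) (just b′) | ⊕-view a′ b′
  ... | _ | additive _      | _ | additive _        = sum∼
  ... | _ | additive ab     | _ | nonadditive ¬a′b′ = ¬a′b′ (to ab)
  ... | _ | nonadditive ¬ab | _ | additive a′b′     = ¬ab (from a′b′)
  ... | _ | nonadditive _   | _ | nonadditive _     = tt

  ⊕-cong : ∀ {u u′ v v′} → u ≈ u′ → v ≈ v′ → op u v ≈ op u′ v′
  ⊕-cong {nothing} {nothing} {v} {v′} _ _ = ≈-∞ (∞-absorbˡ v) (∞-absorbˡ v′)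
  ⊕-cong {just a} {just a′} {nothing} {nothing} _ _ =
    ≈-∞ (∞-absorbʳ (just a)) (∞-absorbʳ (just a′))
  ⊕-cong {just a} {just a′} {just b} {just b′} a∼a′ b∼b′ =
    ≈-⊕ (additive-resp a∼a′ b∼b′) (additive-resp (∼-sym a∼a′) (∼-sym b∼b′)) (∙-cong-∼ a∼a′ b∼b′)

  ⊕-assoc-just : ∀ a b c →
                 op (op (just a) (just b)) (just c) ≈ op (just a) (op (just b) (just c))
  ⊕-assoc-just a b c with op (just a) (just b) | ⊕-view a b | op (just b) (just c) | ⊕-view b c
  ... | _ | additive ab | _ | additive bc =
    ≈-⊕ (proj₂ ∘ additive-assocˡ ab) (proj₂ ∘ additive-assocʳ bc) (∼-reflexive (assoc a b c))
  ... | _ | additive ab | _ | nonadditive ¬bc =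
    ≈-∞ (⊕-nonadditive (¬bc ∘ proj₁ ∘ additive-assocˡ ab)) (∞-absorbʳ (just a))
  ... | _ | nonadditive ¬ab | _ | additive bc =
    ≈-∞ (∞-absorbˡ (just c)) (⊕-nonadditive (¬ab ∘ proj₁ ∘ additive-assocʳ bc))
  ... | _ | nonadditive _ | _ | nonadditive _ = ≈-∞ (∞-absorbˡ (just c)) (∞-absorbʳ (just a))

  ⊕-assoc : ∀ u v w → op (op u v) w ≈ op u (op v w)
  ⊕-assoc nothing v w rewrite ∞-absorbˡ v | ∞-absorbˡ w | ∞-absorbˡ (op v w) = tt
  ⊕-assoc (just a) nothing w rewrite ∞-absorbʳ (just a) | ∞-absorbˡ w | ∞-absorbʳ (just a) = tt
  ⊕-assoc (just a) (just b) nothing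
    rewrite ∞-absorbʳ (op (just a) (just b)) | ∞-absorbʳ (just b) | ∞-absorbʳ (just a) = tt
  ⊕-assoc (just a) (just b) (just c) = ⊕-assoc-just a b c

  ⊕-comm : ∀ u v → op u v ≈ op v u
  ⊕-comm nothing  v        = ≈-∞ (∞-absorbˡ v) (∞-absorbʳ v)
  ⊕-comm (just a) nothing  = ≈-∞ (∞-absorbʳ (just a)) (∞-absorbˡ (just a))
  ⊕-comm (just a) (just b) = ≈-⊕ additive-comm additive-comm (∼-reflexive (comm a b))

  ⊕-identityˡ : ∀ u → op (just 0ᴳ) u ≈ u
  ⊕-identityˡ nothing  = ≈-∞ (∞-absorbʳ (just 0ᴳ)) refl
  ⊕-identityˡ (just a) =
    subst (_≈ just a) (sym (⊕-additive (additive-0ᴳˡ a))) (∼-reflexive (identityˡ a))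

  isCommutativeMonoid : IsCommutativeMonoid _≈_ op (just 0ᴳ)
  isCommutativeMonoid = record
    { isMonoid = record
      { isSemigroup = record
        { isMagma = record { isEquivalence = ≈-isEquivalence ; ∙-cong = ⊕-cong }
        ; assoc   = ⊕-assoc
        }
      ; identity = ⊕-identityˡ , λ u → ≈-trans (⊕-comm u (just 0ᴳ)) (⊕-identityˡ u)
      }
    ; comm = ⊕-comm
    }

  pow-just : ∀ {a d} k → pow _≈_ op k (just a) ≡ just d →
             d ≡ suc k ×ᴳ a × (∀ x → InFace G E x → x d ≡ suc k ×ℚ x a)
  pow-just {a} zero refl = sym (identityʳ a) , λ x _ → sym (ℚ.+-identityʳ (x a))
  pow-just {a} (suc k) eq with pow _≈_ op k (just a) in eqₖ
  ... | nothing = case trans (sym eq) (∞-absorbʳ (just a)) of λ ()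
  ... | just d′ with op (just a) (just d′) | ⊕-view a d′
  ...   | _ | nonadditive _ = case eq of λ ()
  ...   | _ | additive ad′ with refl ← eq with d′≡ , xd′≡ ← pow-just k eqₖ =
    cong (a +ᴳ_) d′≡ , λ x x∈F → trans (sym (ad′ x x∈F)) (cong (x a +_) (xd′≡ x x∈F))

  nilpotent : ∀ u → ¬ (u ≈ just 0ᴳ) → IsNilpotent _≈_ op nothing u
  nilpotent nothing  _ = 0 , tt
  nilpotent (just a) a≁0 with n , suc-n·a≡0 ← ×-order a with pow _≈_ op n (just a) in eq
  ... | nothing = n , subst (_≈ nothing) (sym eq) tt
  ... | just d with d≡ , xd≡ ← pow-just n eq = contradiction (kunz⇒∼0ᴳ a∈H) a≁0
    where
    open ≡-Reasoning
    a∈H : InKunz G E a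
    a∈H x x∈F = suc×p≡0⇒p≡0 n (begin
      suc n ×ℚ x a  ≡⟨ xd≡ x x∈F ⟨
      x d           ≡⟨ cong x (trans d≡ suc-n·a≡0) ⟩
      x 0ᴳ          ≡⟨ kunz-0ᴳ x x∈F ⟩
      0ℚ            ∎)

  isNilsemigroupWithIdentity : IsNilsemigroupWithIdentity _≈_ op (just 0ᴳ) nothing
  isNilsemigroupWithIdentity =
    (λ u → proj₂ identity u , proj₁ identity u) ,
    (λ u → ≈-∞ (∞-absorbʳ u) refl , ≈-∞ (∞-absorbˡ u) refl) ,
    nilpotent
    where open IsCommutativeMonoid isCommutativeMonoid using (identity)

  isPartlyCancellative : IsPartlyCancellative _≈_ op nothing
  isPartlyCancellative nothing  u≉∞ = contradiction tt u≉∞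
  isPartlyCancellative (just a) _ nothing _ _ a∞≉∞ =
    contradiction (≈-∞ (∞-absorbʳ (just a)) refl) a∞≉∞
  isPartlyCancellative (just a) _ (just b) nothing ab≈a∞ ab≉∞ =
    contradiction (≈-trans ab≈a∞ (≈-∞ (∞-absorbʳ (just a)) refl)) ab≉∞
  isPartlyCancellative (just a) _ (just b) (just c) ab≈ac ab≉∞
    with op (just a) (just b) | ⊕-view a b | op (just a) (just c) | ⊕-view a c
  ... | _ | additive _    | _ | additive _ = ∼-cancelˡ ab≈ac
  ... | _ | nonadditive _ | _ | _          = contradiction tt ab≉∞

  _∣_ : Fin m → Fin m → Set
  a ∣ b = Σ (Fin m) λ c → op (just a) (just c) ≈ just b

  ∣⇒kunzLeq : ∀ {a b} → a ∣ b → KunzLeq G E a b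
  ∣⇒kunzLeq {a} {b} (c , a+c≈b) with op (just a) (just c) | ⊕-view a c | kunz? a
  ... | _ | additive _  | yes a∈H = inj₂ (inj₁ a∈H)
  ... | _ | additive ac | no a∉H  = inj₂ (inj₂ (a∉H , b∉H , additive-resp ∼-refl c∼b-a ac))
    where
    b∉H : ¬ InKunz G E b
    b∉H b∈H = a∉H (additive-kunz⇒kunz ac λ x x∈F →
                     trans (kunz-periodic a+c≈b x x∈F) (b∈H x x∈F))
    c∼b-a : c ∼ (b +ᴳ (-ᴳ a))
    c∼b-a = ∼-cancelˡ (∼-trans a+c≈b (∼-reflexive (sym (x+[y-x]≡y a b))))

  additive⇒∣ : ∀ {a b} → Additive G E a (b +ᴳ (-ᴳ a)) → a ∣ b
  additive⇒∣ {a} {b} ab-a =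
    b +ᴳ (-ᴳ a) , subst (_≈ just b) (sym (⊕-additive ab-a)) (∼-reflexive (x+[y-x]≡y a b))

  kunzLeq⇒∣ : ∀ {a b} → KunzLeq G E a b → a ∣ b
  kunzLeq⇒∣ {a} {b} (inj₁ a∼b) = 0ᴳ ,
    subst (_≈ just b) (sym (⊕-additive (additive-0ᴳʳ a))) (∼-trans (∼-reflexive (identityʳ a)) a∼b)
  kunzLeq⇒∣ (inj₂ (inj₁ a∈H))          = additive⇒∣ (kunz⇒additive a∈H _)
  kunzLeq⇒∣ (inj₂ (inj₂ (_ , _ , ab-a))) = additive⇒∣ ab-a

theorem3p3 : (G : FinAbGroup) (E : PairSet G) → ValidPairs G E →
  (op : N G → N G → N G) → IsKunzOp G E op →
    IsCommutativeMonoid (≈N G E) op (just (FinAbGroup.0ᴳ G)) ×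
    IsNilsemigroupWithIdentity (≈N G E) op (just (FinAbGroup.0ᴳ G)) nothing ×
    IsPartlyCancellative (≈N G E) op nothing ×
    ((a b : Fin (FinAbGroup.m G)) →
      ((Σ (Fin (FinAbGroup.m G)) λ c → ≈N G E (op (just a) (just c)) (just b)) → KunzLeq G E a b) ×
      (KunzLeq G E a b → Σ (Fin (FinAbGroup.m G)) λ c → ≈N G E (op (just a) (just c)) (just b)))
theorem3p3 G E _ op isKunzOp =
  isCommutativeMonoid , isNilsemigroupWithIdentity , isPartlyCancellative ,
  λ a b → ∣⇒kunzLeq , kunzLeq⇒∣
  where open KunzNilsemigroup G E op isKunzOp
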